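{- For every integer $n$ with $2 \le n \le 8$, $\Gamma(G_n) = 2n-1$.
   Context: For a finite simple graph $G$ and $k \in \mathbb{N}$, a $k$-complete coloring of $G$ is a map $c: V(G) \to [k] = \{1,\dots,k\}$ such that for every pair of distinct colors $i \ne j$ in $[k]$ there is an edge $\{u,v\} \in E(G)$ with $c(u)=i$ and $c(v)=j$ (adjacent vertices may receive the same color). The complete coloring number $\Gamma(G)$ is the largest $k$ for which a $k$-complete coloring of $G$ exists. $G_n$ denotes the $n \times n$ square grid graph: vertices $(i,j) \in \mathbb{Z}^2$ with $1 \le i,j \le n$, and $(i_1,j_1) \sim (i_2,j_2)$ iff $|i_1-i_2|+|j_1-j_2| = 1$. -}

module Defs where

open import Data.Nat using (ℕ; _+_; _≤_; ∣_-_∣)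
open import Data.Fin using (Fin; toℕ)
open import Data.Product using (_×_; ∃; ∃-syntax; _,_)
open import Relation.Binary.PropositionalEquality using (_≡_; _≢_)

IsCompleteColoring : {V : Set} (Adj : V → V → Set) (k : ℕ) (c : V → Fin k) → Set
IsCompleteColoring {V} Adj k c =
  (i j : Fin k) → i ≢ j → ∃[ u ] ∃[ v ] (Adj u v × c u ≡ i × c v ≡ j)

HasCompleteColoring : {V : Set} (Adj : V → V → Set) (k : ℕ) → Set
HasCompleteColoring {V} Adj k = ∃[ c ] IsCompleteColoring {V} Adj k c

CompleteColoringNumberIs : {V : Set} (Adj : V → V → Set) (m : ℕ) → Set
CompleteColoringNumberIs {V} Adj m =
  HasCompleteColoring {V} Adj m × ((k : ℕ) → HasCompleteColoring {V} Adj k → k ≤ m)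

-- The n × n grid graph G_n: vertices (i , j) with coordinates in Fin n
-- (i.e. 0..n-1, a shift of 1..n), adjacent iff |i1-i2| + |j1-j2| = 1.
GridV : ℕ → Set
GridV n = Fin n × Fin n

GridAdj : (n : ℕ) → GridV n → GridV n → Set
GridAdj n (i₁ , j₁) (i₂ , j₂) = ∣ toℕ i₁ - toℕ i₂ ∣ + ∣ toℕ j₁ - toℕ j₂ ∣ ≡ 1

module Submission where

-- In a complete colouring with k colours every
--    ordered pair (i , j) of distinct colours is carried by some arc, i.e. an
--    ordered pair (u , v) of adjacent vertices; distinct colour pairs need
--    distinct arcs, so k (k − 1) ≤ #arcs.  For the grid #arcs = 4n(n − 1),
--    which is smaller than (2n)(2n − 1); hence no 2n-complete colouring exists.
--  * Lower bound (witness).  Being a complete colouring is decidable, so a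
--    concrete (2n − 1)-colouring of G_n, given as a table, is verified by
--    evaluation.

open import Defs
open import Data.Nat using (ℕ; _≤_; _*_; _∸_)
open import Data.Nat using (zero; suc; _+_; ∣_-_∣; _<_; _<?_; _≤?_; _≟_; s≤s; z≤n)
open import Data.Nat.Properties using (≤-trans; ≤-pred; ≰⇒>; <⇒≱; *-mono-≤)
open import Data.Fin using (Fin; toℕ; punchIn; remQuot)
open import Data.Fin.Properties using (punchInᵢ≢i; punchIn-injective; injective⇒≤; *↔×; all?)
import Data.Fin.Properties as Fin
open import Data.Vec using (Vec; []; _∷_)
import Data.Vec as Vec
open import Data.List using (List; length; lookup; filter; cartesianProduct; allFin)
open import Data.List.Relation.Unary.Any using (Any; index; any?)
open import Data.List.Relation.Unary.Any.Properties using (lookup-index)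
open import Data.List.Membership.Propositional using (_∈_; find; lose)
open import Data.List.Membership.Propositional.Properties
  using (∈-filter⁺; ∈-filter⁻; ∈-cartesianProduct⁺; ∈-allFin)
open import Data.Product using (∃-syntax; _×_; _,_; proj₁; proj₂)
open import Data.Product.Properties using (≡-dec)
open import Data.Sum using (_⊎_; inj₁; inj₂)
open import Data.Empty using (⊥-elim)
open import Function using (_∘_)
open import Function.Definitions using (Injective)
open import Function.Bundles using (Injection)
open import Function.Properties.Inverse using (Inverse⇒Injection)
open import Relation.Nullary using (Dec; yes; no; contradiction)
open import Relation.Nullary.Decidable using (True; toWitness; map′; _⊎-dec_)
open import Relation.Unary using (Decidable)
open import Relation.Binary.PropositionalEquality using (_≡_; _≢_; refl; sym; trans; cong; cong₂; module ≡-Reasoning)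

-- Pronic numbers (m + 1) m are strictly increasing, so an upper bound L on one
-- of them that lies below (m + 1) m forces the index below m.
pronic-bound : ∀ {m k L} → L < suc m * m → suc k * k ≤ L → suc k ≤ m
pronic-bound {m} {k} L<pronic pronic≤L with suc k ≤? m
... | yes k<m = k<m
... | no  k≮m = contradiction (≤-trans (*-mono-≤ (s≤s m≤k) m≤k) pronic≤L) (<⇒≱ L<pronic)
  where
  m≤k : m ≤ k
  m≤k = ≤-pred (≰⇒> k≮m)

-- Pairs (i , j) of distinct colours out of k + 1, enumerated by Fin (k + 1) × Fin k.
distinctPair : ∀ {k} → Fin (suc k) × Fin k → Fin (suc k) × Fin (suc k)
distinctPair (i , d) = i , punchIn i d

distinctPair-distinct : ∀ {k} (x : Fin (suc k) × Fin k) → proj₁ (distinctPair x) ≢ proj₂ (distinctPair x)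
distinctPair-distinct (i , d) = punchInᵢ≢i i d ∘ sym

distinctPair-injective : ∀ {k} → Injective _≡_ _≡_ (distinctPair {k})
distinctPair-injective {x = i , d} {y = i′ , d′} same with cong proj₁ same
... | refl = cong (i ,_) (punchIn-injective i d d′ (cong proj₂ same))

remQuot-injective : ∀ {m} n → Injective _≡_ _≡_ (remQuot {m} n)
remQuot-injective {m} n = Injection.injective (Inverse⇒Injection (*↔× {m} {n}))

module FiniteGraph {V : Set} (Adj : V → V → Set) (adj? : ∀ u v → Dec (Adj u v))
                   (vertices : List V) (listed : ∀ v → v ∈ vertices) where

  -- Arcs are ordered pairs of adjacent vertices; each edge gives two arcs.
  IsArc : V × V → Set
  IsArc (u , v) = Adj u v

  isArc? : Decidable IsArc
  isArc? (u , v) = adj? u v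

  arcs : List (V × V)
  arcs = filter isArc? (cartesianProduct vertices vertices)

  arc-listed : ∀ {u v} → Adj u v → (u , v) ∈ arcs
  arc-listed {u} {v} = ∈-filter⁺ isArc? (∈-cartesianProduct⁺ (listed u) (listed v))

  arc-adjacent : ∀ {a} → a ∈ arcs → IsArc a
  arc-adjacent = proj₂ ∘ ∈-filter⁻ isArc? {xs = cartesianProduct vertices vertices}

  module _ {k : ℕ} (c : V → Fin k) where

    arcColours : V × V → Fin k × Fin k
    arcColours (u , v) = c u , c v

    -- Colours i, j are joined when they coincide or some arc carries them;
    -- completeness says all pairs are joined, which is a finite search.
    Joined : Fin k → Fin k → Set
    Joined i j = i ≡ j ⊎ Any (λ a → arcColours a ≡ (i , j)) arcs

    joined? : ∀ i j → Dec (Joined i j)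
    joined? i j = (i Fin.≟ j) ⊎-dec any? (λ a → ≡-dec Fin._≟_ Fin._≟_ (arcColours a) (i , j)) arcs

    complete⇒joined : IsCompleteColoring Adj k c → ∀ i j → Joined i j
    complete⇒joined cc i j with i Fin.≟ j
    ... | yes i≡j = inj₁ i≡j
    ... | no  i≢j with cc i j i≢j
    ...   | u , v , u~v , cu≡i , cv≡j = inj₂ (lose (arc-listed u~v) (cong₂ _,_ cu≡i cv≡j))

    joined⇒complete : (∀ i j → Joined i j) → IsCompleteColoring Adj k c
    joined⇒complete joined i j i≢j with joined i j
    ... | inj₁ i≡j = ⊥-elim (i≢j i≡j)
    ... | inj₂ carried with find carried
    ...   | (u , v) , uv∈arcs , colours≡ =
            u , v , arc-adjacent uv∈arcs , cong proj₁ colours≡ , cong proj₂ colours≡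

    complete? : Dec (IsCompleteColoring Adj k c)
    complete? = map′ joined⇒complete complete⇒joined (all? λ i → all? λ j → joined? i j)

  -- Counting: a complete colouring with k + 1 colours picks, for every pair
  -- of distinct colours, an arc carrying it; different pairs get different
  -- arcs, so (k + 1) k ≤ #arcs.
  module Counting {k : ℕ} (c : V → Fin (suc k)) (cc : IsCompleteColoring Adj (suc k) c) where

    coloursAt : Fin (length arcs) → Fin (suc k) × Fin (suc k)
    coloursAt p = arcColours c (lookup arcs p)

    arcFor : (x : Fin (suc k) × Fin k) → ∃[ p ] coloursAt p ≡ distinctPair x
    arcFor x@(i , d) with cc i (punchIn i d) (distinctPair-distinct x)
    ... | u , v , u~v , cu≡i , cv≡j =
          index uv∈arcs
        , trans (cong (arcColours c) (sym (lookup-index uv∈arcs))) (cong₂ _,_ cu≡i cv≡j)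
      where
      uv∈arcs : (u , v) ∈ arcs
      uv∈arcs = arc-listed u~v

    arcFor-injective : Injective _≡_ _≡_ (proj₁ ∘ arcFor)
    arcFor-injective {x} {y} same = distinctPair-injective (begin
      distinctPair x              ≡⟨ sym (proj₂ (arcFor x)) ⟩
      coloursAt (proj₁ (arcFor x)) ≡⟨ cong coloursAt same ⟩
      coloursAt (proj₁ (arcFor y)) ≡⟨ proj₂ (arcFor y) ⟩
      distinctPair y              ∎)
      where open ≡-Reasoning

    colour-pairs≤arcs : suc k * k ≤ length arcs
    colour-pairs≤arcs =
      injective⇒≤ {f = proj₁ ∘ arcFor ∘ remQuot k}
                  (remQuot-injective {suc k} k ∘ arcFor-injective)

  Γ-upper : ∀ m → length arcs < suc m * m → ∀ k → HasCompleteColoring Adj k → k ≤ m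
  Γ-upper m few-arcs zero    _        = z≤n
  Γ-upper m few-arcs (suc k) (c , cc) =
    pronic-bound few-arcs (Counting.colour-pairs≤arcs c cc)

  Γ-exact : ∀ m (c : V → Fin m) → {True (complete? c)} → {True (length arcs <? suc m * m)} →
            CompleteColoringNumberIs Adj m
  Γ-exact m c {complete} {few-arcs} =
    (c , toWitness complete) , Γ-upper m (toWitness few-arcs)

gridVertices : (n : ℕ) → List (GridV n)
gridVertices n = cartesianProduct (allFin n) (allFin n)

gridVertex-listed : ∀ n (v : GridV n) → v ∈ gridVertices n
gridVertex-listed n (i , j) = ∈-cartesianProduct⁺ (∈-allFin i) (∈-allFin j)

gridAdj? : ∀ n (u v : GridV n) → Dec (GridAdj n u v)
gridAdj? n (i₁ , j₁) (i₂ , j₂) = ∣ toℕ i₁ - toℕ i₂ ∣ + ∣ toℕ j₁ - toℕ j₂ ∣ ≟ 1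

module Grid (n : ℕ) = FiniteGraph (GridAdj n) (gridAdj? n) (gridVertices n) (gridVertex-listed n)

-- A colouring of G_n given as an n × n table of colours, row i listing (i , j).
Table : ℕ → ℕ → Set
Table k n = Vec (Vec (Fin k) n) n

fromTable : ∀ {k n} → Table k n → GridV n → Fin k
fromTable t (i , j) = Vec.lookup (Vec.lookup t i) j

gridΓ : ∀ {n m} (t : Table m n) →
        {True (Grid.complete? n (fromTable t))} →
        {True (length (Grid.arcs n) <? suc m * m)} →
        CompleteColoringNumberIs (GridAdj n) m
gridΓ {n} {m} t {complete} {few-arcs} = Grid.Γ-exact n m (fromTable t) {complete} {few-arcs}

module ColouringTables where
  open import Agda.Builtin.FromNat using (Number; fromNat)
  import Data.Fin.Literals as Fin
  import Data.Nat.Literals as ℕ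
  open import Data.Unit using (tt)

  instance
    finNumber : ∀ {k} → Number (Fin k)
    finNumber {k} = Fin.number k

    natNumber : Number ℕ
    natNumber = ℕ.number

  table₂ : Table 3 2
  table₂ = (0 ∷ 2 ∷ []) ∷ (0 ∷ 1 ∷ []) ∷ []

  table₃ : Table 5 3
  table₃ = (0 ∷ 1 ∷ 4 ∷ []) ∷ (4 ∷ 3 ∷ 2 ∷ []) ∷ (2 ∷ 0 ∷ 1 ∷ []) ∷ []

  table₄ : Table 7 4
  table₄ =
    (4 ∷ 0 ∷ 3 ∷ 6 ∷ []) ∷
    (3 ∷ 2 ∷ 1 ∷ 2 ∷ []) ∷
    (5 ∷ 5 ∷ 6 ∷ 4 ∷ []) ∷
    (4 ∷ 1 ∷ 0 ∷ 5 ∷ []) ∷ []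

  table₅ : Table 9 5
  table₅ =
    (8 ∷ 7 ∷ 3 ∷ 4 ∷ 2 ∷ []) ∷
    (7 ∷ 6 ∷ 1 ∷ 8 ∷ 3 ∷ []) ∷
    (0 ∷ 5 ∷ 7 ∷ 2 ∷ 6 ∷ []) ∷
    (2 ∷ 1 ∷ 4 ∷ 5 ∷ 8 ∷ []) ∷
    (4 ∷ 0 ∷ 6 ∷ 3 ∷ 0 ∷ []) ∷ []

  table₆ : Table 11 6
  table₆ =
    (0 ∷ 6 ∷  8 ∷ 4 ∷  9 ∷  6 ∷ []) ∷
    (2 ∷ 1 ∷  5 ∷ 0 ∷  8 ∷  7 ∷ []) ∷
    (7 ∷ 8 ∷  2 ∷ 4 ∷ 10 ∷  5 ∷ []) ∷
    (1 ∷ 3 ∷  6 ∷ 5 ∷  9 ∷  3 ∷ []) ∷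
    (9 ∷ 7 ∷  4 ∷ 3 ∷  2 ∷ 10 ∷ []) ∷
    (0 ∷ 10 ∷ 1 ∷ 0 ∷  7 ∷  6 ∷ []) ∷ []

  table₇ : Table 13 7
  table₇ =
    ( 5 ∷  7 ∷  6 ∷  4 ∷  3 ∷  9 ∷  1 ∷ []) ∷
    ( 9 ∷  8 ∷ 12 ∷  1 ∷  5 ∷  7 ∷ 10 ∷ []) ∷
    ( 7 ∷  2 ∷  4 ∷  9 ∷ 12 ∷ 11 ∷  6 ∷ []) ∷
    ( 4 ∷  5 ∷  8 ∷  0 ∷  3 ∷  2 ∷  0 ∷ []) ∷
    ( 0 ∷ 11 ∷  3 ∷  7 ∷  1 ∷  6 ∷  5 ∷ []) ∷
    ( 1 ∷  8 ∷ 10 ∷ 12 ∷  2 ∷  9 ∷ 10 ∷ []) ∷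
    (11 ∷  6 ∷  3 ∷  0 ∷ 10 ∷ 11 ∷  4 ∷ []) ∷ []

  table₈ : Table 15 8
  table₈ =
    (12 ∷  0 ∷  9 ∷ 10 ∷ 13 ∷  8 ∷ 11 ∷  4 ∷ []) ∷
    (14 ∷  2 ∷ 11 ∷ 14 ∷  1 ∷  5 ∷ 13 ∷ 14 ∷ []) ∷
    ( 3 ∷ 13 ∷  6 ∷  4 ∷  8 ∷  0 ∷  7 ∷  5 ∷ []) ∷
    ( 4 ∷  0 ∷ 14 ∷  9 ∷  3 ∷ 10 ∷  6 ∷  9 ∷ []) ∷
    ( 7 ∷  3 ∷ 12 ∷ 12 ∷ 11 ∷  1 ∷  0 ∷  2 ∷ []) ∷
    ( 8 ∷  6 ∷  5 ∷  4 ∷ 10 ∷  7 ∷ 11 ∷  5 ∷ []) ∷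
    ( 2 ∷ 12 ∷ 10 ∷ 14 ∷  8 ∷  9 ∷  1 ∷  3 ∷ []) ∷
    ( 6 ∷  1 ∷  2 ∷  7 ∷ 12 ∷ 13 ∷  4 ∷  2 ∷ []) ∷ []

open ColouringTables

theorem1 : (n : ℕ) → 2 ≤ n → n ≤ 8 →
    CompleteColoringNumberIs {GridV n} (GridAdj n) (2 * n ∸ 1)
theorem1 2 _ _ = gridΓ table₂
theorem1 3 _ _ = gridΓ table₃
theorem1 4 _ _ = gridΓ table₄
theorem1 5 _ _ = gridΓ table₅
theorem1 6 _ _ = gridΓ table₆
theorem1 7 _ _ = gridΓ table₇
theorem1 8 _ _ = gridΓ table₈
theorem1 0 () _
theorem1 1 (s≤s ()) _
theorem1 (suc (suc (suc (suc (suc (suc (suc (suc (suc _))))))))) _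
  (s≤s (s≤s (s≤s (s≤s (s≤s (s≤s (s≤s (s≤s ()))))))))
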